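{- Let $k\geq 1$ be an integer and $\ell=4k(3k+6)$. Let $W_k$ be the graph constructed as follows: start with vertex set $\{(x,y): x\in[k],\ y\in[\ell]\}$ and edges $\{(x,y),(x,y+1)\}$ for $x\in[k]$, $y\in[\ell-1]$; then for every $y\in[3k+6]$: (1) for every $x\in[k-1]$ add the edge $\{(x,4k(y-1)+4x-3),(x+1,4k(y-1)+4x-2)\}$; (2) add the two new vertices $(k+1,4ky-2)$ and $(k+2,4ky-1)$; (3) add the two edges $\{(k,4ky-3),(k+1,4ky-2)\}$ and $\{(k+1,4ky-2),(k+2,4ky-1)\}$. Then $W_k$ is a 2-layer $k$-planar graph.
   Context: For integers $n\ge1$, $[n]=\{1,\dots,n\}$. Let $G=(X\cup Y,E)$ be a bipartite graph with bipartition $(X,Y)$, $n_X=|X|$, $n_Y=|Y|$. A 2-layer drawing of $G$ is a pair $\pi=(\pi_X,\pi_Y)$ of bijections $\pi_X\colon X\to[n_X]$, $\pi_Y\colon Y\to[n_Y]$. In $\pi$, an edge $\{x_1,y_1\}$ ($x_1\in X$, $y_1\in Y$) crosses an edge $\{x_2,y_2\}$ ($x_2\in X$, $y_2\in Y$) iff either $\pi_X(x_1)<\pi_X(x_2)$ and $\pi_Y(y_1)>\pi_Y(y_2)$, or $\pi_X(x_1)>\pi_X(x_2)$ and $\pi_Y(y_1)<\pi_Y(y_2)$. The drawing is 2-layer $k$-planar if every edge crosses at most $k$ edges. A graph is 2-layer $k$-planar if it has some bipartition $(X,Y)$ admitting a 2-layer $k$-planar drawing. -}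

module Defs where

open import Data.Nat using (ℕ; zero; suc; _+_; _*_; _∸_; _≤_; _<_; _<?_)
open import Data.Bool using (Bool; true; false; if_then_else_)
open import Data.Product using (_×_; _,_; Σ; ∃; ∃-syntax)
open import Data.Sum using (_⊎_)
open import Data.List using (List; []; _∷_; map; concatMap; upTo; filter; length; _++_)
open import Data.List.Relation.Unary.All using (All)
open import Data.List.Relation.Binary.Permutation.Propositional using (_↭_)
open import Relation.Binary.PropositionalEquality using (_≡_; _≢_)
open import Relation.Nullary using (Dec; yes; no)
open import Relation.Nullary.Decidable using (_×-dec_; _⊎-dec_)

-- Finite graphs given by an explicit vertex list and edge list.
-- An edge {u,v} is stored once as the pair (u , v).

record Graph (V : Set) : Set where
  constructor mkGraph
  field
    vertices : List V
    edges    : List (V × V)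
open Graph public

[_] : ℕ → List ℕ
[ n ] = map suc (upTo n)

-- A bipartition (X,Y) of the vertex set is given by
-- side : V → Bool (true = X, false = Y).  Positions are given by one map
-- pos : V → ℕ whose restriction to X is a bijection X → [n_X] and whose
-- restriction to Y is a bijection Y → [n_Y].

module _ {V : Set} (G : Graph V) (side : V → Bool) where

  Xs Ys : List V
  Xs = filter (λ v → side v Data.Bool.≟ true) (vertices G)
  Ys = filter (λ v → side v Data.Bool.≟ false) (vertices G)

  IsBipartition : Set
  IsBipartition = All (λ e → side (Data.Product.proj₁ e) ≢ side (Data.Product.proj₂ e)) (edges G)

  Is2LayerDrawing : (V → ℕ) → Set
  Is2LayerDrawing pos = (map pos Xs ↭ [ length Xs ]) × (map pos Ys ↭ [ length Ys ])

  xEnd yEnd : V × V → V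
  xEnd (u , v) = if side u then u else v
  yEnd (u , v) = if side u then v else u

  module _ (pos : V → ℕ) where

    Crosses : V × V → V × V → Set
    Crosses e f =
      (pos (xEnd e) < pos (xEnd f) × pos (yEnd f) < pos (yEnd e)) ⊎
      (pos (xEnd f) < pos (xEnd e) × pos (yEnd e) < pos (yEnd f))

    crosses? : ∀ e f → Dec (Crosses e f)
    crosses? e f =
      ((pos (xEnd e) <? pos (xEnd f)) ×-dec (pos (yEnd f) <? pos (yEnd e))) ⊎-dec
      ((pos (xEnd f) <? pos (xEnd e)) ×-dec (pos (yEnd e) <? pos (yEnd f)))

    crossingCount : V × V → ℕ
    crossingCount e = length (filter (crosses? e) (edges G))

    IsKPlanarDrawing : ℕ → Set
    IsKPlanarDrawing k = All (λ e → crossingCount e ≤ k) (edges G)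

TwoLayerKPlanar : {V : Set} → ℕ → Graph V → Set
TwoLayerKPlanar {V} k G =
  Σ (V → Bool) λ side → IsBipartition G side ×
  Σ (V → ℕ) λ pos → Is2LayerDrawing G side pos × IsKPlanarDrawing G side pos k

ℓ : ℕ → ℕ
ℓ k = 4 * k * (3 * k + 6)

W : ℕ → Graph (ℕ × ℕ)
W k = mkGraph verts edgs
  where
  grid : List (ℕ × ℕ)
  grid = concatMap (λ x → map (λ y → (x , y)) [ ℓ k ]) [ k ]

  extra : List (ℕ × ℕ)
  extra = concatMap (λ y → (k + 1 , 4 * k * y ∸ 2) ∷ (k + 2 , 4 * k * y ∸ 1) ∷ []) [ 3 * k + 6 ]

  verts : List (ℕ × ℕ)
  verts = grid ++ extra

  pathEdges : List ((ℕ × ℕ) × (ℕ × ℕ))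
  pathEdges = concatMap (λ x → map (λ y → ((x , y) , (x , y + 1))) [ ℓ k ∸ 1 ]) [ k ]

  -- for each y ∈ [3k+6]: steps (1) and (3)
  blockEdges : ℕ → List ((ℕ × ℕ) × (ℕ × ℕ))
  blockEdges y =
    map (λ x → ((x , 4 * k * (y ∸ 1) + 4 * x ∸ 3) , (x + 1 , 4 * k * (y ∸ 1) + 4 * x ∸ 2))) [ k ∸ 1 ]
    ++ ((k , 4 * k * y ∸ 3) , (k + 1 , 4 * k * y ∸ 2))
    ∷ ((k + 1 , 4 * k * y ∸ 2) , (k + 2 , 4 * k * y ∸ 1))
    ∷ []

  edgs : List ((ℕ × ℕ) × (ℕ × ℕ))
  edgs = pathEdges ++ concatMap blockEdges [ 3 * k + 6 ]

-- Put (x , y) on the first layer iff its column y is odd, and order each layer column by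
-- column (by y, then by x). Every edge of W k is a step from (a , c) to (b , c + 1) with
-- b ∈ {a , a + 1}, and in this drawing two steps cross only if they lie in adjacent columns
-- and interleave. So an edge of the path in row x crosses no edge of its own path and at most
-- one edge of each other path, while a diagonal edge crosses at most one edge of each of the
-- k paths. The diagonal edges occupy pairwise distinct columns, ≡ 1 (mod 4) in rows ≤ k and
-- ≡ 2 (mod 4) in row k + 1; hence no two diagonal edges cross and no path edge crosses two
-- of them, and every edge crosses at most (k - 1) + 1 resp. k + 0 edges.

module Submission where

open import Level using (Level; 0ℓ)
open import Function using (_∘_; _on_)
open import Data.Nat using (ℕ; zero; suc; _+_; _*_; _∸_; _%_; _≤_; _<_; _>_; z≤n; s≤s; z<s; s<s)
open import Data.Nat.Properties
open import Data.Nat.DivMod using (%-distribˡ-+; [m+kn]%n≡m%n)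
open import Data.Nat.Tactic.RingSolver using (solve-∀)
open import Data.Bool using (Bool; true; false; not)
open import Data.Bool.Properties using (¬-not; not-¬)
import Data.Bool as Bool
open import Data.Product using (_×_; _,_; proj₁; proj₂; swap)
open import Data.Product.Relation.Binary.Lex.Strict using (×-Lex; ×-isStrictTotalOrder)
open import Data.Product.Relation.Binary.Pointwise.NonDependent using (≡×≡⇒≡) renaming (Pointwise to _×ᵖ_)
open import Data.Sum using (_⊎_; inj₁; inj₂)
open import Data.Empty using (⊥-elim)
open import Data.List
  using ( List; []; _∷_; map; concat; concatMap; _++_; _∷ʳ_; filter; length
        ; upTo; applyUpTo; applyDownFrom; reverse; cartesianProduct)
open import Data.List.Properties
  using ( filter-++; length-++; filter-none; filter-accept; filter-reject; filter-notAll; length-map; length-upTo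
        ; map-∘; map-cong; map-cong-local; map-upTo; concatMap-cong; ++-assoc; applyUpTo-∷ʳ; reverse-applyUpTo)
open import Data.List.Membership.Propositional using (_∈_)
open import Data.List.Relation.Unary.Any as Any using (here; there)
open import Data.List.Relation.Unary.All as All using (All; []; _∷_)
import Data.List.Relation.Unary.All.Properties as All
open import Data.List.Relation.Unary.AllPairs as AllPairs using (AllPairs; []; _∷_)
import Data.List.Relation.Unary.AllPairs.Properties as AllPairs
open import Data.List.Relation.Unary.Linked.Properties using (Linked⇒AllPairs)
open import Data.List.Relation.Unary.Unique.Propositional using (Unique)
import Data.List.Relation.Unary.Unique.Propositional.Properties as Unique
open import Data.List.Relation.Binary.Permutation.Propositional using (_↭_; ↭-sym; ↭⇒↭ₛ; module PermutationReasoning)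
open import Data.List.Relation.Binary.Permutation.Propositional.Properties using (All-resp-↭; ↭-length; ↭-reverse)
import Data.List.Relation.Binary.Permutation.Setoid.Properties as Permₛ
import Relation.Binary.Construct.Flip.EqAndOrd as Flip
open import Data.List.Sort (Flip.decTotalOrder ≤-decTotalOrder) using (sort; sort-↭; sort-↗)
open import Relation.Binary.Core using (Rel)
open import Relation.Binary.Structures using (IsStrictTotalOrder)
open import Relation.Binary.Definitions using (Tri; tri<; tri≈; tri>)
open import Relation.Binary.PropositionalEquality
  using (_≡_; _≢_; refl; sym; trans; cong; cong₂; subst; setoid; isEquivalence; resp₂; module ≡-Reasoning)
open import Relation.Nullary using (¬_; yes; no; contradiction)
open import Relation.Unary using (Pred; Decidable; _⊆_; ∁)
open import Defs

private
  variable
    a b p q r s : Level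
    A B : Set a

module _ {P : Pred A p} (P? : Decidable P) where

  count : List A → ℕ
  count xs = length (filter P? xs)

  count-++ : ∀ xs ys → count (xs ++ ys) ≡ count xs + count ys
  count-++ xs ys = trans (cong length (filter-++ P? xs ys)) (length-++ (filter P? xs))

  count-none : ∀ {xs} → All (∁ P) xs → count xs ≡ 0
  count-none ¬Pxs = cong length (filter-none P? ¬Pxs)

  count≤1 : ∀ {xs} → AllPairs (λ x y → ¬ (P x × P y)) xs → count xs ≤ 1
  count≤1 [] = z≤n
  count≤1 {x ∷ xs} (x∦xs ∷ xs∦) with P? x
  ... | yes px = s≤s (≤-reflexive (count-none (All.map (λ x∦y py → x∦y (px , py)) x∦xs)))
  ... | no _   = count≤1 xs∦

  module _ (f : B → List A) where

    count-concatMap-≤ : ∀ {ys} → All (λ y → count (f y) ≤ 1) ys → count (concatMap f ys) ≤ length ys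
    count-concatMap-≤ {[]} [] = z≤n
    count-concatMap-≤ {y ∷ ys} (fy≤1 ∷ fys≤1) = begin
      count (f y ++ concatMap f ys)          ≡⟨ count-++ (f y) (concatMap f ys) ⟩
      count (f y) + count (concatMap f ys)   ≤⟨ +-mono-≤ fy≤1 (count-concatMap-≤ fys≤1) ⟩
      suc (length ys)                        ∎
      where open ≤-Reasoning

    count-concatMap-< : ∀ {y ys} → All (λ y → count (f y) ≤ 1) ys → y ∈ ys → count (f y) ≡ 0 →
                        count (concatMap f ys) < length ys
    count-concatMap-< {ys = y ∷ ys} (_ ∷ fys≤1) (here refl) fy≡0 = begin-strict
      count (f y ++ concatMap f ys)          ≡⟨ count-++ (f y) (concatMap f ys) ⟩
      count (f y) + count (concatMap f ys)   ≡⟨ cong (_+ _) fy≡0 ⟩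
      count (concatMap f ys)                 <⟨ s≤s (count-concatMap-≤ fys≤1) ⟩
      suc (length ys)                        ∎
      where open ≤-Reasoning
    count-concatMap-< {ys = y' ∷ ys} (fy'≤1 ∷ fys≤1) (there y∈ys) fy≡0 = begin-strict
      count (f y' ++ concatMap f ys)         ≡⟨ count-++ (f y') (concatMap f ys) ⟩
      count (f y') + count (concatMap f ys)  <⟨ +-mono-≤-< fy'≤1 (count-concatMap-< fys≤1 y∈ys fy≡0) ⟩
      suc (length ys)                        ∎
      where open ≤-Reasoning

module _ {P : Pred A p} {Q : Pred A q} (P? : Decidable P) (Q? : Decidable Q) (P⊆Q : P ⊆ Q) where

  count-mono : ∀ xs → count P? xs ≤ count Q? xs
  count-mono [] = z≤n
  count-mono (x ∷ xs) with P? x | Q? x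
  ... | yes _  | yes _  = s≤s (count-mono xs)
  ... | yes px | no ¬qx = ⊥-elim (¬qx (P⊆Q px))
  ... | no _   | yes _  = m≤n⇒m≤1+n (count-mono xs)
  ... | no _   | no _   = count-mono xs

  count-mono-< : ∀ {x xs} → x ∈ xs → Q x → ¬ P x → count P? xs < count Q? xs
  count-mono-< {xs = x ∷ xs} (here refl) qx ¬px
    rewrite filter-reject P? {x} {xs} ¬px | filter-accept Q? {x} {xs} qx = s≤s (count-mono xs)
  count-mono-< {xs = y ∷ xs} (there x∈xs) qx ¬px with P? y | Q? y
  ... | yes _  | yes _  = s≤s (count-mono-< x∈xs qx ¬px)
  ... | yes py | no ¬qy = ⊥-elim (¬qy (P⊆Q py))
  ... | no _   | yes _  = m≤n⇒m≤1+n (count-mono-< x∈xs qx ¬px)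
  ... | no _   | no _   = count-mono-< x∈xs qx ¬px

Unique-map∈ : ∀ {f : A → B} {xs} → (∀ {x y} → x ∈ xs → y ∈ xs → f x ≡ f y → x ≡ y) →
              Unique xs → Unique (map f xs)
Unique-map∈ {xs = []} inj [] = []
Unique-map∈ {xs = x ∷ xs} inj (x∉xs ∷ xs!) =
  All.map⁺ (All.tabulate (λ y∈xs fx≡fy → All.lookup x∉xs y∈xs (inj (here refl) (there y∈xs) fx≡fy)))
  ∷ Unique-map∈ (λ x∈xs y∈xs → inj (there x∈xs) (there y∈xs)) xs!

AllPairs-mapWith-All : ∀ {P : Pred A p} {R : Rel A r} {S : Rel A s} {xs} → (∀ {x y} → P x → P y → R x y → S x y) →
                       All P xs → AllPairs R xs → AllPairs S xs
AllPairs-mapWith-All f [] [] = []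
AllPairs-mapWith-All f (px ∷ pxs) (Rx ∷ Rxs) =
  All.zipWith (λ (py , Rxy) → f px py Rxy) (pxs , Rx) ∷ AllPairs-mapWith-All f pxs Rxs

[]-bounds : ∀ n → All (λ x → 1 ≤ x × x ≤ n) [ n ]
[]-bounds n = All.map⁺ (All.applyUpTo⁺₁ (λ i → i) n (λ i<n → s≤s z≤n , i<n))

[]-increasing : ∀ n → AllPairs _<_ [ n ]
[]-increasing n = AllPairs.map⁺ (AllPairs.applyUpTo⁺₁ (λ i → i) n (λ i<j _ → s≤s i<j))

length-[] : ∀ n → length [ n ] ≡ n
length-[] n = trans (length-map suc (upTo n)) (length-upTo n)

[]-unique : ∀ n → Unique [ n ]
[]-unique n = AllPairs.map <⇒≢ ([]-increasing n)

concatMap-cartesianProduct : ∀ (xs : List A) (ys : List B) → concatMap (λ x → map (x ,_) ys) xs ≡ cartesianProduct xs ys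
concatMap-cartesianProduct []       ys = refl
concatMap-cartesianProduct (x ∷ xs) ys = cong (map (x ,_) ys ++_) (concatMap-cartesianProduct xs ys)

length-descending-≤ : ∀ {m xs} → AllPairs _>_ xs → All (λ x → 1 ≤ x × x ≤ m) xs → length xs ≤ m
length-descending-≤ [] [] = z≤n
length-descending-≤ (x>xs ∷ xs↓) ((s≤s _ , x≤m) ∷ bounds) =
  ≤-trans (s≤s (length-descending-≤ xs↓ (All.zipWith (λ (y<x , 1≤y , _) → 1≤y , ≤-pred y<x) (x>xs , bounds)))) x≤m

descending≡downFrom : ∀ n {xs} → AllPairs _>_ xs → All (λ x → 1 ≤ x × x ≤ n) xs → length xs ≡ n →
                      xs ≡ applyDownFrom suc n
descending≡downFrom zero {[]} [] [] refl = refl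
descending≡downFrom (suc n) {suc x ∷ xs} (x>xs ∷ xs↓) ((_ , x≤n) ∷ bounds) len =
  cong₂ _∷_ (cong suc x≡n) (descending≡downFrom n xs↓ bounds′ (suc-injective len))
  where
  below : All (λ y → 1 ≤ y × y ≤ x) xs
  below = All.zipWith (λ (y<x , 1≤y , _) → 1≤y , ≤-pred y<x) (x>xs , bounds)
  x≡n : x ≡ n
  x≡n = ≤-antisym (≤-pred x≤n) (subst (_≤ x) (suc-injective len) (length-descending-≤ xs↓ below))
  bounds′ : All (λ y → 1 ≤ y × y ≤ n) xs
  bounds′ = All.map (λ (1≤y , y≤x) → 1≤y , subst (_ ≤_) x≡n y≤x) below

Unique⇒↭[] : ∀ n {xs} → Unique xs → All (λ x → 1 ≤ x × x ≤ n) xs → length xs ≡ n → xs ↭ [ n ]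
Unique⇒↭[] n {xs} xs! bounds len = begin
  xs                        ↭⟨ sort-↭ xs ⟨
  sort xs                   ≡⟨ descending≡downFrom n sorted↓ (All-resp-↭ (↭-sym (sort-↭ xs)) bounds) sorted-length ⟩
  applyDownFrom suc n       ≡⟨ reverse-applyUpTo suc n ⟨
  reverse (applyUpTo suc n) ↭⟨ ↭-reverse (applyUpTo suc n) ⟩
  applyUpTo suc n           ≡⟨ map-upTo suc n ⟨
  [ n ]                     ∎
  where
  open PermutationReasoning
  sorted! : Unique (sort xs)
  sorted! = Permₛ.Unique-resp-↭ (setoid ℕ) (↭⇒↭ₛ (↭-sym (sort-↭ xs))) xs!
  sorted↓ : AllPairs _>_ (sort xs)
  sorted↓ = AllPairs.zipWith (λ (y≤x , x≢y) → ≤∧≢⇒< y≤x (x≢y ∘ sym))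
              (Linked⇒AllPairs (λ z≤y y≤x → ≤-trans y≤x z≤y) (sort-↗ xs) , sorted!)
  sorted-length : length (sort xs) ≡ n
  sorted-length = trans (↭-length (sort-↭ xs)) len

-- Ranks with respect to a strict total order

module Rank {A : Set a} {_≺_ : Rel A r} (≺-isStrictTotalOrder : IsStrictTotalOrder _≡_ _≺_) where

  open IsStrictTotalOrder ≺-isStrictTotalOrder using (compare) renaming (_<?_ to _≺?_; trans to ≺-trans; irrefl to ≺-irrefl)

  rank : List A → A → ℕ
  rank L v = suc (count (_≺? v) L)

  rank-mono : ∀ L {v w} → v ≺ w → rank L v ≤ rank L w
  rank-mono L v≺w = s≤s (count-mono (_≺? _) (_≺? _) (λ u≺v → ≺-trans u≺v v≺w) L)

  rank-mono-< : ∀ L {v w} → v ∈ L → v ≺ w → rank L v < rank L w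
  rank-mono-< L v∈L v≺w = s≤s (count-mono-< (_≺? _) (_≺? _) (λ u≺v → ≺-trans u≺v v≺w) v∈L v≺w (≺-irrefl refl))

  rank-reflects : ∀ L {v w} → rank L v < rank L w → v ≺ w
  rank-reflects L {v} {w} rv<rw with compare v w
  ... | tri< v≺w _ _ = v≺w
  ... | tri≈ _ refl _ = contradiction rv<rw (<-irrefl refl)
  ... | tri> _ _ w≺v = contradiction (rank-mono L w≺v) (<⇒≱ rv<rw)

  rank-injective : ∀ L {v w} → v ∈ L → w ∈ L → rank L v ≡ rank L w → v ≡ w
  rank-injective L {v} {w} v∈L w∈L rv≡rw with compare v w
  ... | tri< v≺w _ _ = contradiction rv≡rw (<⇒≢ (rank-mono-< L v∈L v≺w))
  ... | tri≈ _ v≡w _ = v≡w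
  ... | tri> _ _ w≺v = contradiction (sym rv≡rw) (<⇒≢ (rank-mono-< L w∈L w≺v))

  rank≤length : ∀ L {v} → v ∈ L → rank L v ≤ length L
  rank≤length L v∈L = filter-notAll (_≺? _) L (Any.map (λ { refl → ≺-irrefl refl }) v∈L)

  map-rank↭[] : ∀ L → Unique L → map (rank L) L ↭ [ length L ]
  map-rank↭[] L L! = Unique⇒↭[] (length L) (Unique-map∈ (rank-injective L) L!)
    (All.map⁺ (All.tabulate (λ v∈L → s≤s z≤n , rank≤length L v∈L))) (length-map (rank L) L)

-- Crossings in 2-layer drawings

Opposed : Rel A r → A → A → A → A → Set r
Opposed _≺_ u v u' v' = (u ≺ u' × v' ≺ v) ⊎ (u' ≺ u × v ≺ v')

Opposed-swap : ∀ {_≺_ : Rel A r} {u v u' v'} → Opposed _≺_ u v u' v' → Opposed _≺_ v u v' u'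
Opposed-swap (inj₁ (u≺u' , v'≺v)) = inj₂ (v'≺v , u≺u')
Opposed-swap (inj₂ (u'≺u , v≺v')) = inj₁ (v≺v' , u'≺u)

module _ {V : Set} (G : Graph V) (side : V → Bool) (pos : V → ℕ) where

  crosses-aligned : ∀ {u v u' v'} → side u ≡ side u' → Crosses G side pos (u , v) (u' , v') →
                    Opposed (_<_ on pos) u v u' v'
  crosses-aligned {u} {v} {u'} {v'} eq X with side u | side u'
  crosses-aligned refl X | true  | true  = X
  crosses-aligned refl X | false | false = Opposed-swap {_≺_ = _<_ on pos} X
  crosses-aligned ()   X | true  | false
  crosses-aligned ()   X | false | true

  crosses-swapʳ : ∀ {e u' v'} → side u' ≢ side v' → Crosses G side pos e (u' , v') → Crosses G side pos e (v' , u')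
  crosses-swapʳ {u' = u'} {v'} ne X with side u' | side v'
  ... | true  | false = X
  ... | false | true  = X
  ... | true  | true  = contradiction refl ne
  ... | false | false = contradiction refl ne

infix 4 _<ᶜ_
_<ᶜ_ : Rel (ℕ × ℕ) 0ℓ
_<ᶜ_ = ×-Lex _≡_ _<_ _<_ on swap

<ᶜ-isStrictTotalOrder : IsStrictTotalOrder _≡_ _<ᶜ_
<ᶜ-isStrictTotalOrder = record
  { isStrictPartialOrder = record
    { isEquivalence = isEquivalence
    ; irrefl        = λ { refl → Lex.irrefl (refl , refl) }
    ; trans         = Lex.trans
    ; <-resp-≈      = resp₂ _<ᶜ_
    }
  ; compare = λ v w → compare (Lex.compare (swap v) (swap w))
  }
  where
  module Lex = IsStrictTotalOrder (×-isStrictTotalOrder <-isStrictTotalOrder <-isStrictTotalOrder)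
  compare : ∀ {v w} → Tri (v <ᶜ w) ((_≡_ ×ᵖ _≡_) (swap v) (swap w)) (w <ᶜ v) → Tri (v <ᶜ w) (v ≡ w) (w <ᶜ v)
  compare (tri< v<w v≉w w≮v) = tri< v<w (λ { refl → v≉w (refl , refl) }) w≮v
  compare (tri≈ v≮w v≈w w≮v) = tri≈ v≮w (cong swap (≡×≡⇒≡ v≈w)) w≮v
  compare (tri> v≮w v≉w w<v) = tri> v≮w (λ { refl → v≉w (refl , refl) }) w<v

odd : ℕ → Bool
odd zero    = false
odd (suc n) = not (odd n)

columnParity : ℕ × ℕ → Bool
columnParity (x , y) = odd y

Edge : Set
Edge = (ℕ × ℕ) × (ℕ × ℕ)

column : Edge → ℕ
column ((_ , c) , _) = c

vert : ℕ → ℕ → Edge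
vert x y = ((x , y) , (x , suc y))

diag : ℕ → ℕ → Edge
diag a c = ((a , c) , (suc a , suc c))

data Step : Edge → Set where
  step : ∀ {a b c} → a ≤ b → b ≤ suc a → Step ((a , c) , (b , suc c))

vert-step : ∀ x y → Step (vert x y)
vert-step x y = step ≤-refl (n≤1+n x)

diag-step : ∀ a c → Step (diag a c)
diag-step a c = step (n≤1+n a) ≤-refl

StepsCross : Edge → Edge → Set
StepsCross ((a , c) , (b , _)) ((a' , c') , (b' , _)) = (c' ≡ suc c × a' < b) ⊎ (c ≡ suc c' × a < b')

<ᶜ⇒column≤ : ∀ {x y x' y'} → (x , y) <ᶜ (x' , y') → y ≤ y'
<ᶜ⇒column≤ (inj₁ y<y')      = <⇒≤ y<y'
<ᶜ⇒column≤ (inj₂ (refl , _)) = ≤-refl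

steps-not-nested : ∀ {e f} → Step e → Step f → ¬ (proj₁ e <ᶜ proj₁ f × proj₂ f <ᶜ proj₂ e)
steps-not-nested (step _ _) (step _ _) (inj₁ c<c' , 1+c'≤1+c) = <⇒≱ c<c' (≤-pred (<ᶜ⇒column≤ 1+c'≤1+c))
steps-not-nested (step _ _) (step _ _) (inj₂ (refl , _) , inj₁ 1+c<1+c) = <-irrefl refl 1+c<1+c
steps-not-nested (step _ b≤1+a) (step a'≤b' _) (inj₂ (refl , a<a') , inj₂ (_ , b'<b)) =
  <-irrefl refl (≤-trans b'<b (≤-trans b≤1+a (≤-trans a<a' a'≤b')))

steps-not-opposed : ∀ {e f} → Step e → Step f → ¬ Opposed _<ᶜ_ (proj₁ e) (proj₂ e) (proj₁ f) (proj₂ f)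
steps-not-opposed se sf (inj₁ e-outside) = steps-not-nested se sf e-outside
steps-not-opposed se sf (inj₂ f-outside) = steps-not-nested sf se f-outside

opposed-steps-cross : ∀ {e f} → Step e → Step f → column e ≢ column f →
                      Opposed _<ᶜ_ (proj₁ e) (proj₂ e) (proj₂ f) (proj₁ f) → StepsCross e f
opposed-steps-cross (step _ _) (step _ _) c≢c' (inj₁ (inj₁ c<1+c' , inj₁ c'<1+c)) =
  contradiction (≤-antisym (≤-pred c<1+c') (≤-pred c'<1+c)) c≢c'
opposed-steps-cross (step _ _) (step _ _) _ (inj₁ (inj₁ _ , inj₂ next)) = inj₁ next
opposed-steps-cross (step _ _) (step _ _) _ (inj₁ (inj₂ previous , _)) = inj₂ previous
opposed-steps-cross (step _ _) (step _ _) _ (inj₂ (1+c'≤c , 1+c≤c')) =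
  ⊥-elim (<-asym (<ᶜ⇒column≤ 1+c'≤c) (<ᶜ⇒column≤ 1+c≤c'))

module ColumnMajor {G : Graph (ℕ × ℕ)} {pos : ℕ × ℕ → ℕ}
  (pos-reflects : ∀ {v w} → columnParity v ≡ columnParity w → pos v < pos w → v <ᶜ w) where

  reflect : ∀ {u v u' v'} → columnParity u ≡ columnParity u' → columnParity v ≡ columnParity v' →
            Opposed (_<_ on pos) u v u' v' → Opposed _<ᶜ_ u v u' v'
  reflect pu pv (inj₁ (u<u' , v'<v)) = inj₁ (pos-reflects pu u<u' , pos-reflects (sym pv) v'<v)
  reflect pu pv (inj₂ (u'<u , v<v')) = inj₂ (pos-reflects (sym pu) u'<u , pos-reflects pv v<v')

  -- If the two steps start in columns of equal parity, their lower ends lie on the same layer and a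
  -- crossing would nest one step inside the other; otherwise a crossing makes them interleave.
  crosses⇒stepsCross : ∀ {e f} → Step e → Step f → Crosses G columnParity pos e f → StepsCross e f
  crosses⇒stepsCross {e} se@(step {c = c} _ _) sf@(step {c = c'} _ _) X with odd c Bool.≟ odd c'
  ... | yes same = contradiction (reflect same (cong not same) (crosses-aligned G columnParity pos same X))
                                 (steps-not-opposed se sf)
  ... | no diff  = opposed-steps-cross se sf (diff ∘ cong odd)
                     (reflect (¬-not diff) (sym (¬-not (diff ∘ sym)))
                       (crosses-aligned G columnParity pos (¬-not diff)
                         (crosses-swapʳ G columnParity pos {e = e} (not-¬ refl) X)))

-- The graph W k for k ≥ 1

residue-order-≤ : ∀ {i j q q'} → i < j → q ≤ q' → i + q * 4 < j + q' * 4
residue-order-≤ i<j q≤q' = +-mono-<-≤ i<j (*-monoˡ-≤ 4 q≤q')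

residue-order-< : ∀ {i j q q'} → i < 4 → q < q' → i + q * 4 < j + q' * 4
residue-order-< {i} {j} {q} {q'} i<4 q<q' = begin-strict
  i + q * 4  <⟨ +-monoˡ-< (q * 4) i<4 ⟩
  suc q * 4  ≤⟨ *-monoˡ-≤ 4 q<q' ⟩
  q' * 4     ≤⟨ m≤n+m (q' * 4) j ⟩
  j + q' * 4 ∎
  where open ≤-Reasoning

residue-shift : ∀ j c {r r'} → c % 4 ≡ r → (j + c) % 4 ≡ r' → r' ≡ (j % 4 + r) % 4
residue-shift j c c≡r j+c≡r' = trans (sym j+c≡r') (trans (%-distribˡ-+ j c 4) (cong (λ r → (j % 4 + r) % 4) c≡r))

data SpecialPosition (k : ℕ) : ℕ → ℕ → Set where
  inner : ∀ {a c} → c % 4 ≡ 1 → a ≤ k → SpecialPosition k a c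
  outer : ∀ {c} → c % 4 ≡ 2 → SpecialPosition k (suc k) c

data Special (k : ℕ) : Edge → Set where
  special : ∀ {a c} → SpecialPosition k a c → Special k (diag a c)

specials-adjacent : ∀ {k a c a'} → SpecialPosition k a c → SpecialPosition k a' (suc c) → a < a'
specials-adjacent         (inner _ a≤k) (outer _)     = s≤s a≤k
specials-adjacent {c = c} (inner c≡1 _) (inner c'≡ _) = contradiction (residue-shift 1 c c≡1 c'≡) λ ()
specials-adjacent {c = c} (outer c≡2)   (inner c'≡ _) = contradiction (residue-shift 1 c c≡2 c'≡) λ ()
specials-adjacent {c = c} (outer c≡2)   (outer c'≡)   = contradiction (residue-shift 1 c c≡2 c'≡) λ ()

specials-not-2-apart : ∀ {k a c a'} → SpecialPosition k a c → ¬ SpecialPosition k a' (2 + c)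
specials-not-2-apart {c = c} (inner c≡1 _) (inner c'≡ _) = contradiction (residue-shift 2 c c≡1 c'≡) λ ()
specials-not-2-apart {c = c} (inner c≡1 _) (outer c'≡)   = contradiction (residue-shift 2 c c≡1 c'≡) λ ()
specials-not-2-apart {c = c} (outer c≡2)   (inner c'≡ _) = contradiction (residue-shift 2 c c≡2 c'≡) λ ()
specials-not-2-apart {c = c} (outer c≡2)   (outer c'≡)   = contradiction (residue-shift 2 c c≡2 c'≡) λ ()

inner-start : ∀ k' B x → 4 * suc k' * B + 4 * suc x ≡ 4 + (suc k' * B + x) * 4
inner-start = solve-∀

block-end : ∀ k' B → 4 * suc k' * suc B ≡ 4 + (suc k' * B + k') * 4
block-end = solve-∀

∸3-diag : ∀ x N q → N ≡ 4 + q * 4 → ((x , N ∸ 3) , (x + 1 , N ∸ 2)) ≡ diag x (1 + q * 4)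
∸3-diag x _ q refl = cong (λ x+1 → ((x , 1 + q * 4) , (x+1 , 2 + q * 4))) (+-comm x 1)

∸2-diag : ∀ x N q → N ≡ 4 + q * 4 → ((x + 1 , N ∸ 2) , (x + 2 , N ∸ 1)) ≡ diag (suc x) (2 + q * 4)
∸2-diag x _ q refl = cong₂ (λ x+1 x+2 → ((x+1 , 2 + q * 4) , (x+2 , 3 + q * 4))) (+-comm x 1) (+-comm x 2)

module EdgesOfW (k' : ℕ) where

  private
    k : ℕ
    k = suc k'

  pathRow : ℕ → List Edge
  pathRow x = map (vert x) [ ℓ k ∸ 1 ]

  pathEdges : List Edge
  pathEdges = concatMap pathRow [ k ]

  innerStep : ℕ → ℕ → Edge
  innerStep B x = diag (suc x) (1 + (k * B + x) * 4)

  outerStep : ℕ → Edge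
  outerStep B = diag (suc k) (2 + (k * B + k') * 4)

  block : ℕ → List Edge
  block B = applyUpTo (innerStep B) k ++ outerStep B ∷ []

  specialEdges : List Edge
  specialEdges = concatMap block (upTo (3 * k + 6))

  block-special : ∀ B → All (Special k) (block B)
  block-special B = All.++⁺
    (All.applyUpTo⁺₁ (innerStep B) k (λ {x} x<k → special (inner ([m+kn]%n≡m%n 1 (k * B + x) 4) x<k)))
    (special (outer ([m+kn]%n≡m%n 2 (k * B + k') 4)) ∷ [])

  specialEdges-special : All (Special k) specialEdges
  specialEdges-special = All.concat⁺ (All.map⁺ (All.universal block-special (upTo (3 * k + 6))))

  block-increasing : ∀ B → AllPairs (λ e f → column e < column f) (block B)
  block-increasing B = AllPairs.++⁺
    (AllPairs.applyUpTo⁺₁ (innerStep B) k (λ x<y _ → residue-order-< {1} (s<s z<s) (+-monoʳ-< (k * B) x<y)))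
    ([] ∷ [])
    (All.applyUpTo⁺₁ (innerStep B) k (λ x<k → residue-order-≤ {1} ≤-refl (+-monoʳ-≤ (k * B) (≤-pred x<k)) ∷ []))

  block-bounds : ∀ B → All (λ e → k * B * 4 < column e × column e < (k * B + k) * 4) (block B)
  block-bounds B = All.++⁺
    (All.applyUpTo⁺₁ (innerStep B) k (λ {x} x<k →
      residue-order-≤ {0} {1} z<s (m≤m+n (k * B) x) , residue-order-< {1} {0} (s<s z<s) (+-monoʳ-< (k * B) x<k)))
    ((residue-order-≤ {0} {2} z<s (m≤m+n (k * B) k') , residue-order-< {2} {0} (s<s (s<s z<s)) (+-monoʳ-< (k * B) ≤-refl)) ∷ [])

  blocks-increasing : ∀ {B B'} → B < B' → All (λ e → All (λ f → column e < column f) (block B')) (block B)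
  blocks-increasing {B} {B'} B<B' =
    All.map (λ (_ , e<) → All.map (λ (<f , _) → <-trans e< (≤-<-trans gap <f)) (block-bounds B')) (block-bounds B)
    where
    gap : (k * B + k) * 4 ≤ k * B' * 4
    gap = *-monoˡ-≤ 4 (subst (_≤ k * B') (trans (*-suc k B) (+-comm k (k * B))) (*-monoʳ-≤ k B<B'))

  specialEdges-increasing : AllPairs (λ e f → column e < column f) specialEdges
  specialEdges-increasing = AllPairs.concat⁺
    (All.map⁺ (All.universal block-increasing (upTo (3 * k + 6))))
    (AllPairs.map⁺ (AllPairs.applyUpTo⁺₁ (λ B → B) (3 * k + 6) (λ B<B' _ → blocks-increasing B<B')))

  -- The left-hand side is block y = suc B of the diagonal edges in the definition of W k.
  block≡ : ∀ B →
    map (λ x → ((x , 4 * k * B + 4 * x ∸ 3) , (x + 1 , 4 * k * B + 4 * x ∸ 2))) [ k' ]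
      ++ ((k , 4 * k * suc B ∸ 3) , (k + 1 , 4 * k * suc B ∸ 2))
      ∷ ((k + 1 , 4 * k * suc B ∸ 2) , (k + 2 , 4 * k * suc B ∸ 1)) ∷ []
    ≡ block B
  block≡ B = begin
    map wInner (map suc (upTo k')) ++ wLastInner ∷ wOuter ∷ []
      ≡⟨ cong (λ es → es ++ wLastInner ∷ wOuter ∷ []) inner-steps ⟩
    applyUpTo (innerStep B) k' ++ wLastInner ∷ wOuter ∷ []
      ≡⟨ cong₂ (λ e e' → applyUpTo (innerStep B) k' ++ e ∷ e' ∷ [])
               (∸3-diag k _ (k * B + k') (block-end k' B)) (∸2-diag k _ (k * B + k') (block-end k' B)) ⟩
    applyUpTo (innerStep B) k' ++ innerStep B k' ∷ outerStep B ∷ []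
      ≡⟨ ++-assoc (applyUpTo (innerStep B) k') (innerStep B k' ∷ []) (outerStep B ∷ []) ⟨
    (applyUpTo (innerStep B) k' ∷ʳ innerStep B k') ++ outerStep B ∷ []
      ≡⟨ cong (_++ outerStep B ∷ []) (applyUpTo-∷ʳ (innerStep B) k') ⟩
    block B ∎
    where
    open ≡-Reasoning
    wInner : ℕ → Edge
    wInner x = ((x , 4 * k * B + 4 * x ∸ 3) , (x + 1 , 4 * k * B + 4 * x ∸ 2))
    wLastInner wOuter : Edge
    wLastInner = ((k , 4 * k * suc B ∸ 3) , (k + 1 , 4 * k * suc B ∸ 2))
    wOuter = ((k + 1 , 4 * k * suc B ∸ 2) , (k + 2 , 4 * k * suc B ∸ 1))
    inner-steps : map wInner (map suc (upTo k')) ≡ applyUpTo (innerStep B) k'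
    inner-steps = begin
      map wInner (map suc (upTo k'))  ≡⟨ map-∘ (upTo k') ⟨
      map (wInner ∘ suc) (upTo k')    ≡⟨ map-cong (λ x → ∸3-diag (suc x) _ (k * B + x) (inner-start k' B x)) (upTo k') ⟩
      map (innerStep B) (upTo k')     ≡⟨ map-upTo (innerStep B) k' ⟩
      applyUpTo (innerStep B) k'      ∎

  edges-W : edges (W k) ≡ pathEdges ++ specialEdges
  edges-W = cong₂ _++_
    (concatMap-cong (λ x → map-cong (λ y → cong (λ y+1 → ((x , y) , (x , y+1))) (+-comm y 1)) [ ℓ k ∸ 1 ]) [ k ])
    (trans (cong concat (sym (map-∘ (upTo (3 * k + 6))))) (concatMap-cong block≡ (upTo (3 * k + 6))))

module VerticesOfW (k' : ℕ) where

  open EdgesOfW k' using (outerStep)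

  private
    k : ℕ
    k = suc k'

  extraPair : ℕ → List (ℕ × ℕ)
  extraPair y = (k + 1 , 4 * k * y ∸ 2) ∷ (k + 2 , 4 * k * y ∸ 1) ∷ []

  grid extra : List (ℕ × ℕ)
  grid = concatMap (λ x → map (λ y → (x , y)) [ ℓ k ]) [ k ]
  extra = concatMap extraPair [ 3 * k + 6 ]

  extra-increasing : AllPairs (λ v w → proj₂ v < proj₂ w) extra
  extra-increasing = subst (AllPairs _) (sym extra≡) (AllPairs.concat⁺
      (All.map⁺ (All.universal (λ _ → (n<1+n _ ∷ []) ∷ [] ∷ []) (upTo (3 * k + 6))))
      (AllPairs.map⁺ (AllPairs.applyUpTo⁺₁ (λ B → B) (3 * k + 6) (λ B<B' _ → apart B<B'))))
    where
    ends : Edge → List (ℕ × ℕ)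
    ends (u , v) = u ∷ v ∷ []
    -- the two vertices added with block y = suc B are the ends of its outer step
    extra≡ : extra ≡ concatMap (ends ∘ outerStep) (upTo (3 * k + 6))
    extra≡ = trans (cong concat (sym (map-∘ {g = extraPair} {f = suc} (upTo (3 * k + 6)))))
      (concatMap-cong (λ B → cong ends (∸2-diag k _ (k * B + k') (block-end k' B))) (upTo (3 * k + 6)))
    apart : ∀ {B B'} → B < B' → All (λ v → All (λ w → proj₂ v < proj₂ w) (ends (outerStep B'))) (ends (outerStep B))
    apart {B} {B'} B<B' = (before 2<4 ∷ before 2<4 ∷ []) ∷ (before 3<4 ∷ before 3<4 ∷ []) ∷ []
      where
      before : ∀ {i j} → i < 4 → i + (k * B + k') * 4 < j + (k * B' + k') * 4
      before i<4 = residue-order-< i<4 (+-monoˡ-< k' (*-monoʳ-< k B<B'))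
      2<4 : 2 < 4
      2<4 = s<s (s<s z<s)
      3<4 : 3 < 4
      3<4 = s<s (s<s (s<s z<s))

  grid-extra-disjoint : ∀ {v} → ¬ (v ∈ grid × v ∈ extra)
  grid-extra-disjoint (v∈grid , v∈extra) = <⇒≱ (All.lookup extra-right v∈extra) (All.lookup grid-left v∈grid)
    where
    row-left : ∀ {x} → 1 ≤ x × x ≤ k → All (λ v → proj₁ v ≤ k) (map (x ,_) [ ℓ k ])
    row-left (_ , x≤k) = All.map⁺ (All.universal (λ _ → x≤k) [ ℓ k ])
    grid-left : All (λ v → proj₁ v ≤ k) grid
    grid-left = All.concat⁺ (All.map⁺ (All.map row-left ([]-bounds k)))
    extra-right : All (λ v → k < proj₁ v) extra
    extra-right = All.concat⁺ (All.map⁺ (All.universal (λ _ → m<m+n k z<s ∷ m<m+n k z<s ∷ []) [ 3 * k + 6 ]))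

  vertices-unique : Unique (vertices (W k))
  vertices-unique = Unique.++⁺ grid-unique extra-unique grid-extra-disjoint
    where
    grid-unique : Unique grid
    grid-unique = subst Unique (sym (concatMap-cartesianProduct [ k ] [ ℓ k ]))
                    (Unique.cartesianProduct⁺ ([]-unique k) ([]-unique (ℓ k)))
    extra-unique : Unique extra
    extra-unique = AllPairs.map (λ v<w v≡w → <-irrefl (cong proj₂ v≡w) v<w) extra-increasing

module DrawingOfW (k' : ℕ) where

  open EdgesOfW k'
  open VerticesOfW k' using (vertices-unique)
  open Rank <ᶜ-isStrictTotalOrder

  private
    k : ℕ
    k = suc k'

  layer : Bool → List (ℕ × ℕ)
  layer s = filter (λ v → columnParity v Bool.≟ s) (vertices (W k))

  pos : ℕ × ℕ → ℕ
  pos v = rank (layer (columnParity v)) v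

  pos-reflects : ∀ {v w} → columnParity v ≡ columnParity w → pos v < pos w → v <ᶜ w
  pos-reflects {v} {w} same pv<pw =
    rank-reflects (layer (columnParity v)) (subst (λ s → pos v < rank (layer s) w) (sym same) pv<pw)

  layer-drawing : ∀ s → map pos (layer s) ↭ [ length (layer s) ]
  layer-drawing s = subst (_↭ [ length (layer s) ]) (sym pos≡rank)
    (map-rank↭[] (layer s) (Unique.filter⁺ (λ v → columnParity v Bool.≟ s) vertices-unique))
    where
    pos≡rank : map pos (layer s) ≡ map (rank (layer s)) (layer s)
    pos≡rank = map-cong-local (All.map (λ {v} v∈s → cong (λ s → rank (layer s) v) v∈s)
                                       (All.all-filter (λ v → columnParity v Bool.≟ s) (vertices (W k))))

  drawing : Is2LayerDrawing (W k) columnParity pos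
  drawing = layer-drawing true , layer-drawing false

  bipartite : IsBipartition (W k) columnParity
  bipartite = subst (All (λ e → columnParity (proj₁ e) ≢ columnParity (proj₂ e))) (sym edges-W) (All.++⁺
    (All.concat⁺ (All.map⁺ (All.universal (λ _ → All.map⁺ (All.universal (λ _ → not-¬ refl) [ ℓ k ∸ 1 ])) [ k ])))
    (All.map (λ { (special _) → not-¬ refl }) specialEdges-special))

  open ColumnMajor {G = W k} pos-reflects

  Cross : Edge → Edge → Set
  Cross = Crosses (W k) columnParity pos

  cross? : ∀ e → Decidable (Cross e)
  cross? = crosses? (W k) columnParity pos

  crossings : Edge → List Edge → ℕ
  crossings e = count (cross? e)

  pathRow-crossings≤1 : ∀ {e} → Step e → ∀ x → crossings e (pathRow x) ≤ 1
  pathRow-crossings≤1 {e} se@(step {a} {b} {c} _ b≤1+a) x =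
    count≤1 (cross? e) (AllPairs.map⁺ (AllPairs.map never-both ([]-increasing (ℓ k ∸ 1))))
    where
    never-both : ∀ {y y'} → y < y' → ¬ (Cross e (vert x y) × Cross e (vert x y'))
    never-both {y} {y'} y<y' (X , X')
      with crosses⇒stepsCross se (vert-step x y) X | crosses⇒stepsCross se (vert-step x y') X'
    ... | inj₁ (y≡1+c , _) | inj₁ (y'≡1+c , _) = <-irrefl (trans y≡1+c (sym y'≡1+c)) y<y'
    ... | inj₂ (c≡1+y , _) | inj₂ (c≡1+y' , _) = <-irrefl (suc-injective (trans (sym c≡1+y) c≡1+y')) y<y'
    ... | inj₁ (_ , x<b)   | inj₂ (_ , a<x)    = <-irrefl refl (≤-trans x<b (≤-trans b≤1+a a<x))
    ... | inj₂ (_ , a<x)   | inj₁ (_ , x<b)    = <-irrefl refl (≤-trans x<b (≤-trans b≤1+a a<x))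

  pathRow-own-crossings : ∀ x c → crossings (vert x c) (pathRow x) ≡ 0
  pathRow-own-crossings x c = count-none (cross? (vert x c)) (All.map⁺ (All.universal no-cross [ ℓ k ∸ 1 ]))
    where
    no-cross : ∀ y → ¬ Cross (vert x c) (vert x y)
    no-cross y X with crosses⇒stepsCross (vert-step x c) (vert-step x y) X
    ... | inj₁ (_ , x<x) = <-irrefl refl x<x
    ... | inj₂ (_ , x<x) = <-irrefl refl x<x

  paths-crossings≤k : ∀ {e} → Step e → crossings e pathEdges ≤ k
  paths-crossings≤k {e} se = subst (crossings e pathEdges ≤_) (length-[] k)
    (count-concatMap-≤ (cross? e) pathRow (All.universal (pathRow-crossings≤1 se) [ k ]))

  paths-crossings<k : ∀ {x} c → x ∈ [ k ] → crossings (vert x c) pathEdges < k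
  paths-crossings<k {x} c x∈[k] = subst (crossings (vert x c) pathEdges <_) (length-[] k)
    (count-concatMap-< (cross? (vert x c)) pathRow (All.universal (pathRow-crossings≤1 (vert-step x c)) [ k ])
                       x∈[k] (pathRow-own-crossings x c))

  path-specials-crossings≤1 : ∀ x c → crossings (vert x c) specialEdges ≤ 1
  path-specials-crossings≤1 x c =
    count≤1 (cross? (vert x c)) (AllPairs-mapWith-All never-both specialEdges-special specialEdges-increasing)
    where
    never-both : ∀ {f f'} → Special k f → Special k f' → column f < column f' →
                 ¬ (Cross (vert x c) f × Cross (vert x c) f')
    never-both (special {a₁} {c₁} p₁) (special {a₂} {c₂} p₂) c₁<c₂ (X₁ , X₂)
      with crosses⇒stepsCross (vert-step x c) (diag-step a₁ c₁) X₁
         | crosses⇒stepsCross (vert-step x c) (diag-step a₂ c₂) X₂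
    ... | inj₁ (c₁≡1+c , _) | inj₁ (c₂≡1+c , _) = <-irrefl (trans c₁≡1+c (sym c₂≡1+c)) c₁<c₂
    ... | inj₂ (c≡1+c₁ , _) | inj₂ (c≡1+c₂ , _) = <-irrefl (suc-injective (trans (sym c≡1+c₁) c≡1+c₂)) c₁<c₂
    ... | inj₁ (c₁≡1+c , _) | inj₂ (c≡1+c₂ , _) =
      <-asym c₁<c₂ (subst (c₂ <_) (sym (trans c₁≡1+c (cong suc c≡1+c₂))) (m<n⇒m<1+n (n<1+n c₂)))
    ... | inj₂ (c≡1+c₁ , _) | inj₁ (c₂≡1+c , _) =
      specials-not-2-apart p₁ (subst (SpecialPosition k a₂) (trans c₂≡1+c (cong suc c≡1+c₁)) p₂)

  special-specials-crossings≡0 : ∀ {e} → Special k e → crossings e specialEdges ≡ 0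
  special-specials-crossings≡0 {e} (special {a} {c} p) = count-none (cross? e) (All.map no-cross specialEdges-special)
    where
    no-cross : ∀ {f} → Special k f → ¬ Cross e f
    no-cross (special {a'} {c'} p') X with crosses⇒stepsCross (diag-step a c) (diag-step a' c') X
    ... | inj₁ (c'≡1+c , a'≤a) = <⇒≱ (specials-adjacent p (subst (SpecialPosition k a') c'≡1+c p')) (≤-pred a'≤a)
    ... | inj₂ (c≡1+c' , a≤a') = <⇒≱ (specials-adjacent p' (subst (SpecialPosition k a) c≡1+c' p)) (≤-pred a≤a')

  path-edge-crossings≤k : ∀ {x} y → x ∈ [ k ] → crossings (vert x y) (pathEdges ++ specialEdges) ≤ k
  path-edge-crossings≤k {x} y x∈[k] = begin
    crossings e (pathEdges ++ specialEdges)           ≡⟨ count-++ (cross? e) pathEdges specialEdges ⟩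
    crossings e pathEdges + crossings e specialEdges  ≤⟨ +-monoʳ-≤ (crossings e pathEdges) (path-specials-crossings≤1 x y) ⟩
    crossings e pathEdges + 1                         ≡⟨ +-comm (crossings e pathEdges) 1 ⟩
    suc (crossings e pathEdges)                       ≤⟨ paths-crossings<k y x∈[k] ⟩
    k                                                 ∎
    where
    open ≤-Reasoning
    e = vert x y

  special-edge-crossings≤k : ∀ {e} → Special k e → crossings e (pathEdges ++ specialEdges) ≤ k
  special-edge-crossings≤k {e} s@(special {a} {c} _) = begin
    crossings e (pathEdges ++ specialEdges)           ≡⟨ count-++ (cross? e) pathEdges specialEdges ⟩
    crossings e pathEdges + crossings e specialEdges  ≡⟨ cong (crossings e pathEdges +_) (special-specials-crossings≡0 s) ⟩
    crossings e pathEdges + 0                         ≡⟨ +-identityʳ (crossings e pathEdges) ⟩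
    crossings e pathEdges                             ≤⟨ paths-crossings≤k (diag-step a c) ⟩
    k                                                 ∎
    where open ≤-Reasoning

  kPlanar : IsKPlanarDrawing (W k) columnParity pos k
  kPlanar = subst (λ E → All (λ e → count (cross? e) E ≤ k) E) (sym edges-W) (All.++⁺
    (All.concat⁺ (All.map⁺ (All.tabulate (λ x∈[k] →
      All.map⁺ (All.universal (λ y → path-edge-crossings≤k y x∈[k]) [ ℓ k ∸ 1 ])))))
    (All.map special-edge-crossings≤k specialEdges-special))

lemma7 : (k : ℕ) → 1 ≤ k → TwoLayerKPlanar k (W k)
lemma7 (suc k') _ = columnParity , bipartite , pos , drawing , kPlanar
  where open DrawingOfW k'
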